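{- For a pseudo-BCI algebra $A$ the following are equivalent: (a) $A$ is $p$-semisimple; (b) $\mathrm{Ker}(d)=\{1\}$ for every regular type II implicative derivation $d$ on $A$; (c) the identity map $\mathrm{Id}_A$ is the only regular type II implicative derivation on $A$.
   Context: A pseudo-BCI algebra is a structure $(A,\to,\rightsquigarrow,1)$ of type $(2,2,0)$ such that for all $x,y,z\in A$: $(x\to y)\rightsquigarrow[(y\to z)\rightsquigarrow(x\to z)]=1$; $(x\rightsquigarrow y)\to[(y\rightsquigarrow z)\to(x\rightsquigarrow z)]=1$; $1\to x=x$; $1\rightsquigarrow x=x$; and $x\to y=1$, $y\to x=1$ imply $x=y$. Write $x\le y$ iff $x\to y=1$. $A$ is $p$-semisimple if $x\le 1$ implies $x=1$ for all $x\in A$. Put $x\Cup_1 y=(x\to y)\rightsquigarrow y$ and $x\Cup_2 y=(x\rightsquigarrow y)\to y$. A map $d:A\to A$ is a type II implicative derivation if $d(x\to y)=(d(x)\to y)\Cup_2(x\to d(y))$ and $d(x\rightsquigarrow y)=(d(x)\rightsquigarrow y)\Cup_1(x\rightsquigarrow d(y))$ for all $x,y\in A$; it is regular if $d(1)=1$. $\mathrm{Ker}(d)=\{x\in A\mid d(x)=1\}$. -}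

module Defs where

open import Level using (Level; suc; _⊔_)
open import Relation.Binary.PropositionalEquality using (_≡_)
open import Data.Product using (_×_)
open import Function.Bundles using (_⇔_)

record PseudoBCI (a : Level) : Set (suc a) where
  infixr 5 _⟶_ _⇝_
  field
    Carrier : Set a
    _⟶_     : Carrier → Carrier → Carrier
    _⇝_     : Carrier → Carrier → Carrier
    one     : Carrier
    ax1     : ∀ x y z → ((x ⟶ y) ⇝ ((y ⟶ z) ⇝ (x ⟶ z))) ≡ one
    ax2     : ∀ x y z → ((x ⇝ y) ⟶ ((y ⇝ z) ⟶ (x ⇝ z))) ≡ one
    ax3     : ∀ x → (one ⟶ x) ≡ x
    ax4     : ∀ x → (one ⇝ x) ≡ x
    ax5     : ∀ x y → (x ⟶ y) ≡ one → (y ⟶ x) ≡ one → x ≡ y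

module _ {a : Level} (A : PseudoBCI a) where
  open PseudoBCI A

  _≤_ : Carrier → Carrier → Set a
  x ≤ y = (x ⟶ y) ≡ one

  _⋓₁_ : Carrier → Carrier → Carrier
  x ⋓₁ y = (x ⟶ y) ⇝ y

  _⋓₂_ : Carrier → Carrier → Carrier
  x ⋓₂ y = (x ⇝ y) ⟶ y

  IsPSemisimple : Set a
  IsPSemisimple = ∀ x → x ≤ one → x ≡ one

  IsTypeIIImplicativeDerivation : (Carrier → Carrier) → Set a
  IsTypeIIImplicativeDerivation d =
    (∀ x y → d (x ⟶ y) ≡ ((d x ⟶ y) ⋓₂ (x ⟶ d y))) ×
    (∀ x y → d (x ⇝ y) ≡ ((d x ⇝ y) ⋓₁ (x ⇝ d y)))

  IsRegular : (Carrier → Carrier) → Set a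
  IsRegular d = d one ≡ one

  InKer : (Carrier → Carrier) → Carrier → Set a
  InKer d x = d x ≡ one

  KerIsTrivial : (Carrier → Carrier) → Set a
  KerIsTrivial d = ∀ x → (InKer d x ⇔ (x ≡ one))

  AllRegularTypeIIKerTrivial : Set a
  AllRegularTypeIIKerTrivial = (d : Carrier → Carrier) →
    IsTypeIIImplicativeDerivation d → IsRegular d → KerIsTrivial d

  OnlyIdRegularTypeII : Set a
  OnlyIdRegularTypeII = (d : Carrier → Carrier) →
    IsTypeIIImplicativeDerivation d → IsRegular d → ∀ x → d x ≡ x

-- The map x ↦ (x → 1) → 1 is a regular type II implicative derivation: writing
-- x⁻ = x → 1, the map ⁻ interchanges → and ⇝, elements of the form w⁻ are maximal
-- for ≤, and x ≤ x⁻⁻, which together give (x → y)⁻⁻ = x → y⁻⁻ and make both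
-- joins in the derivation identities collapse.  Every x ≤ 1 lies in its kernel,
-- so trivial kernels force p-semisimplicity.  Conversely, any regular type II
-- derivation satisfies x ≤ (x ⇝ d x) → d x = d (1 → x) = d x, and in a
-- p-semisimple algebra ≤ is equality, so d = Id.
module Submission where

open import Defs
open import Level using (Level)
open import Data.Product using (_×_; _,_)
open import Function.Bundles using (_⇔_; mk⇔; Equivalence)
open import Relation.Binary.PropositionalEquality
open ≡-Reasoning

module PseudoBCIProperties {a : Level} (A : PseudoBCI a) where
  open PseudoBCI A

  infix 4 _≼_
  _≼_ : Carrier → Carrier → Set a
  _≼_ = _≤_ A

  ≼-refl : ∀ x → x ≼ x
  ≼-refl x = begin
    x ⟶ x                                  ≡⟨ sym (ax3 (x ⟶ x)) ⟩
    one ⟶ (x ⟶ x)                          ≡⟨ sym (cong₂ (λ u v → u ⟶ (v ⟶ v)) (ax4 one) (ax4 x)) ⟩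
    (one ⇝ one) ⟶ ((one ⇝ x) ⟶ (one ⇝ x))  ≡⟨ ax2 one one x ⟩
    one                                    ∎

  ⇝-refl : ∀ x → (x ⇝ x) ≡ one
  ⇝-refl x = begin
    x ⇝ x                                  ≡⟨ sym (ax4 (x ⇝ x)) ⟩
    one ⇝ (x ⇝ x)                          ≡⟨ sym (cong₂ (λ u v → u ⇝ (v ⇝ v)) (ax3 one) (ax3 x)) ⟩
    (one ⟶ one) ⇝ ((one ⟶ x) ⇝ (one ⟶ x))  ≡⟨ ax1 one one x ⟩
    one                                    ∎

  one≼⇒≡one : ∀ {x} → one ≼ x → x ≡ one
  one≼⇒≡one {x} 1≼x = trans (sym (ax3 x)) 1≼x

  x≼[x⇝y]⟶y : ∀ x y → x ≼ (x ⇝ y) ⟶ y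
  x≼[x⇝y]⟶y x y =
    trans (sym (cong₂ (λ u v → u ⟶ ((x ⇝ y) ⟶ v)) (ax4 x) (ax4 y))) (ax2 one x y)

  x⇝[[x⟶y]⇝y]≡one : ∀ x y → (x ⇝ ((x ⟶ y) ⇝ y)) ≡ one
  x⇝[[x⟶y]⇝y]≡one x y =
    trans (sym (cong₂ (λ u v → u ⇝ ((x ⟶ y) ⇝ v)) (ax3 x) (ax3 y))) (ax1 one x y)

  ≼⇒⇝≡one : ∀ {x y} → x ≼ y → (x ⇝ y) ≡ one
  ≼⇒⇝≡one {x} {y} x≼y = begin
    x ⇝ y                ≡⟨ cong (x ⇝_) (sym (ax4 y)) ⟩
    x ⇝ (one ⇝ y)        ≡⟨ cong (λ u → x ⇝ (u ⇝ y)) (sym x≼y) ⟩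
    x ⇝ ((x ⟶ y) ⇝ y)    ≡⟨ x⇝[[x⟶y]⇝y]≡one x y ⟩
    one                  ∎

  ⇝≡one⇒≼ : ∀ {x y} → (x ⇝ y) ≡ one → x ≼ y
  ⇝≡one⇒≼ {x} {y} x⇝y≡1 = begin
    x ⟶ y                ≡⟨ cong (x ⟶_) (sym (ax3 y)) ⟩
    x ⟶ (one ⟶ y)        ≡⟨ cong (λ u → x ⟶ (u ⟶ y)) (sym x⇝y≡1) ⟩
    x ⟶ ((x ⇝ y) ⟶ y)    ≡⟨ x≼[x⇝y]⟶y x y ⟩
    one                  ∎

  ⟶-antitoneˡ : ∀ {x y} z → x ≼ y → y ⟶ z ≼ x ⟶ z
  ⟶-antitoneˡ {x} {y} z x≼y =
    ⇝≡one⇒≼ (trans (sym (trans (cong (_⇝ _) x≼y) (ax4 _))) (ax1 x y z))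

  ⇝-antitoneˡ : ∀ {x y} z → x ≼ y → y ⇝ z ≼ x ⇝ z
  ⇝-antitoneˡ {x} {y} z x≼y =
    trans (sym (trans (cong (_⟶ _) (≼⇒⇝≡one x≼y)) (ax3 _))) (ax2 x y z)

  ≼-trans : ∀ {x y z} → x ≼ y → y ≼ z → x ≼ z
  ≼-trans {x} {y} {z} x≼y y≼z = begin
    x ⟶ z                          ≡⟨ sym (ax4 _) ⟩
    one ⇝ (x ⟶ z)                  ≡⟨ cong (_⇝ (x ⟶ z)) (sym y≼z) ⟩
    (y ⟶ z) ⇝ (x ⟶ z)              ≡⟨ ≼⇒⇝≡one (⟶-antitoneˡ z x≼y) ⟩
    one                            ∎

  ≼⇝⇒≼⟶ : ∀ {x y z} → x ≼ y ⇝ z → y ≼ x ⟶ z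
  ≼⇝⇒≼⟶ {x} {y} {z} x≼y⇝z = ≼-trans (x≼[x⇝y]⟶y y z) (⟶-antitoneˡ z x≼y⇝z)

  ≼⟶⇒≼⇝ : ∀ {x y z} → y ≼ x ⟶ z → x ≼ y ⇝ z
  ≼⟶⇒≼⇝ {x} {y} {z} y≼x⟶z =
    ≼-trans (⇝≡one⇒≼ (x⇝[[x⟶y]⇝y]≡one x z)) (⇝-antitoneˡ z y≼x⟶z)

  ⟶-prefixing : ∀ x y z → y ⟶ z ≼ (x ⟶ y) ⟶ (x ⟶ z)
  ⟶-prefixing x y z = ≼⇝⇒≼⟶ (⇝≡one⇒≼ (ax1 x y z))

  ⇝-prefixing : ∀ x y z → y ⇝ z ≼ (x ⇝ y) ⇝ (x ⇝ z)
  ⇝-prefixing x y z = ≼⟶⇒≼⇝ (ax2 x y z)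

  ⟶-monotoneʳ : ∀ x {y z} → y ≼ z → x ⟶ y ≼ x ⟶ z
  ⟶-monotoneʳ x {y} {z} y≼z =
    one≼⇒≡one (trans (cong (_⟶ _) (sym y≼z)) (⟶-prefixing x y z))

  ⇝-monotoneʳ : ∀ x {y z} → y ≼ z → x ⇝ y ≼ x ⇝ z
  ⇝-monotoneʳ x {y} {z} y≼z =
    ⇝≡one⇒≼ (one≼⇒≡one (trans (cong (_⟶ _) (sym (≼⇒⇝≡one y≼z))) (⇝-prefixing x y z)))

  ⟶-⇝-exchange : ∀ x y z → x ⟶ (y ⇝ z) ≡ y ⇝ (x ⟶ z)
  ⟶-⇝-exchange x y z = ax5 _ _
    (≼⟶⇒≼⇝ (≼-trans (x≼[x⇝y]⟶y y z) (⟶-prefixing x (y ⇝ z) z)))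
    (≼⇝⇒≼⟶ (≼-trans (⇝≡one⇒≼ (x⇝[[x⟶y]⇝y]≡one x z)) (⇝-prefixing y (x ⟶ z) z)))

  ≼⇒[x⇝y]⟶y≡y : ∀ {x y} → x ≼ y → (x ⇝ y) ⟶ y ≡ y
  ≼⇒[x⇝y]⟶y≡y {x} {y} x≼y = trans (cong (_⟶ y) (≼⇒⇝≡one x≼y)) (ax3 y)

  ≼⇒[x⟶y]⇝y≡y : ∀ {x y} → x ≼ y → (x ⟶ y) ⇝ y ≡ y
  ≼⇒[x⟶y]⇝y≡y {x} {y} x≼y = trans (cong (_⇝ y) x≼y) (ax4 y)

  infix 10 _⁻
  _⁻ : Carrier → Carrier
  x ⁻ = x ⟶ one

  ⁻≡⇝one : ∀ x → x ⁻ ≡ x ⇝ one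
  ⁻≡⇝one x = begin
    x ⟶ one          ≡⟨ cong (x ⟶_) (sym (⇝-refl x)) ⟩
    x ⟶ (x ⇝ x)      ≡⟨ ⟶-⇝-exchange x x x ⟩
    x ⇝ (x ⟶ x)      ≡⟨ cong (x ⇝_) (≼-refl x) ⟩
    x ⇝ one          ∎

  ≼⇒⁻≡ : ∀ {x y} → x ≼ y → x ⁻ ≡ y ⁻
  ≼⇒⁻≡ {x} {y} x≼y = begin
    x ⟶ one          ≡⟨ cong (x ⟶_) (sym (⇝-refl y)) ⟩
    x ⟶ (y ⇝ y)      ≡⟨ ⟶-⇝-exchange x y y ⟩
    y ⇝ (x ⟶ y)      ≡⟨ cong (y ⇝_) x≼y ⟩
    y ⇝ one          ≡⟨ sym (⁻≡⇝one y) ⟩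
    y ⁻              ∎

  ⁻≡[y⇝x]⇝y⁻ : ∀ x y → x ⁻ ≡ (y ⇝ x) ⇝ y ⁻
  ⁻≡[y⇝x]⇝y⁻ x y = begin
    x ⟶ one                  ≡⟨ cong (x ⟶_) (sym (⇝-refl (y ⇝ x))) ⟩
    x ⟶ ((y ⇝ x) ⇝ (y ⇝ x))  ≡⟨ ⟶-⇝-exchange x (y ⇝ x) (y ⇝ x) ⟩
    (y ⇝ x) ⇝ (x ⟶ (y ⇝ x))  ≡⟨ cong ((y ⇝ x) ⇝_) (⟶-⇝-exchange x y x) ⟩
    (y ⇝ x) ⇝ (y ⇝ (x ⟶ x))  ≡⟨ cong (λ u → (y ⇝ x) ⇝ (y ⇝ u)) (≼-refl x) ⟩
    (y ⇝ x) ⇝ (y ⇝ one)      ≡⟨ cong ((y ⇝ x) ⇝_) (sym (⁻≡⇝one y)) ⟩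
    (y ⇝ x) ⇝ y ⁻            ∎

  ⁻≡[y⟶x]⟶y⁻ : ∀ x y → x ⁻ ≡ (y ⟶ x) ⟶ y ⁻
  ⁻≡[y⟶x]⟶y⁻ x y = begin
    x ⁻                      ≡⟨ ⁻≡⇝one x ⟩
    x ⇝ one                  ≡⟨ cong (x ⇝_) (sym (≼-refl (y ⟶ x))) ⟩
    x ⇝ ((y ⟶ x) ⟶ (y ⟶ x))  ≡⟨ sym (⟶-⇝-exchange (y ⟶ x) x (y ⟶ x)) ⟩
    (y ⟶ x) ⟶ (x ⇝ (y ⟶ x))  ≡⟨ cong ((y ⟶ x) ⟶_) (sym (⟶-⇝-exchange y x x)) ⟩
    (y ⟶ x) ⟶ (y ⟶ (x ⇝ x))  ≡⟨ cong (λ u → (y ⟶ x) ⟶ (y ⟶ u)) (⇝-refl x) ⟩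
    (y ⟶ x) ⟶ y ⁻            ∎

  ⁻-⇝-homomorphism : ∀ x y → (y ⇝ x) ⁻ ≡ y ⁻ ⟶ x ⁻
  ⁻-⇝-homomorphism x y = sym (begin
    y ⁻ ⟶ x ⁻                  ≡⟨ cong (y ⁻ ⟶_) (⁻≡[y⇝x]⇝y⁻ x y) ⟩
    y ⁻ ⟶ ((y ⇝ x) ⇝ y ⁻)      ≡⟨ ⟶-⇝-exchange (y ⁻) (y ⇝ x) (y ⁻) ⟩
    (y ⇝ x) ⇝ (y ⁻ ⟶ y ⁻)      ≡⟨ cong ((y ⇝ x) ⇝_) (≼-refl (y ⁻)) ⟩
    (y ⇝ x) ⇝ one              ≡⟨ sym (⁻≡⇝one (y ⇝ x)) ⟩
    (y ⇝ x) ⁻                  ∎)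

  ⁻-⟶-homomorphism : ∀ x y → (y ⟶ x) ⁻ ≡ y ⁻ ⇝ x ⁻
  ⁻-⟶-homomorphism x y = sym (begin
    y ⁻ ⇝ x ⁻                  ≡⟨ cong (y ⁻ ⇝_) (⁻≡[y⟶x]⟶y⁻ x y) ⟩
    y ⁻ ⇝ ((y ⟶ x) ⟶ y ⁻)      ≡⟨ sym (⟶-⇝-exchange (y ⟶ x) (y ⁻) (y ⁻)) ⟩
    (y ⟶ x) ⟶ (y ⁻ ⇝ y ⁻)      ≡⟨ cong ((y ⟶ x) ⟶_) (⇝-refl (y ⁻)) ⟩
    (y ⟶ x) ⁻                  ∎)

  x≼x⁻⁻ : ∀ x → x ≼ x ⁻ ⁻
  x≼x⁻⁻ x = ⇝≡one⇒≼ (trans (cong (x ⇝_) (⁻≡⇝one (x ⁻))) (x⇝[[x⟶y]⇝y]≡one x one))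

  ⁻⁻⁻≡⁻ : ∀ x → x ⁻ ⁻ ⁻ ≡ x ⁻
  ⁻⁻⁻≡⁻ x = sym (≼⇒⁻≡ (x≼x⁻⁻ x))

  ⁻-maximal : ∀ {w v} → w ⁻ ≼ v → v ≡ w ⁻
  ⁻-maximal {w} {v} w⁻≼v = ax5 v (w ⁻) v≼w⁻ w⁻≼v
    where
    v⁻⁻≡w⁻ : v ⁻ ⁻ ≡ w ⁻
    v⁻⁻≡w⁻ = trans (cong _⁻ (sym (≼⇒⁻≡ w⁻≼v))) (⁻⁻⁻≡⁻ w)

    v≼w⁻ : v ≼ w ⁻
    v≼w⁻ = subst (v ≼_) v⁻⁻≡w⁻ (x≼x⁻⁻ v)

  ⁻⁻-⟶ : ∀ x y → (x ⟶ y) ⁻ ⁻ ≡ x ⟶ y ⁻ ⁻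
  ⁻⁻-⟶ x y = sym (⁻-maximal (subst (_≼ x ⟶ y ⁻ ⁻) (sym split) (⟶-antitoneˡ (y ⁻ ⁻) (x≼x⁻⁻ x))))
    where
    split : (x ⟶ y) ⁻ ⁻ ≡ x ⁻ ⁻ ⟶ y ⁻ ⁻
    split = trans (cong _⁻ (⁻-⟶-homomorphism y x)) (⁻-⇝-homomorphism (y ⁻) (x ⁻))

  ⁻⁻-⇝ : ∀ x y → (x ⇝ y) ⁻ ⁻ ≡ x ⇝ y ⁻ ⁻
  ⁻⁻-⇝ x y = sym (⁻-maximal (subst (_≼ x ⇝ y ⁻ ⁻) (sym split) (⇝-antitoneˡ (y ⁻ ⁻) (x≼x⁻⁻ x))))
    where
    split : (x ⇝ y) ⁻ ⁻ ≡ x ⁻ ⁻ ⇝ y ⁻ ⁻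
    split = trans (cong _⁻ (⁻-⇝-homomorphism y x)) (⁻-⟶-homomorphism (y ⁻) (x ⁻))

  ⁻⁻-isTypeIIImplicativeDerivation : IsTypeIIImplicativeDerivation A (λ x → x ⁻ ⁻)
  ⁻⁻-isTypeIIImplicativeDerivation =
      (λ x y → trans (⁻⁻-⟶ x y) (sym (≼⇒[x⇝y]⟶y≡y
        (≼-trans (⟶-antitoneˡ y (x≼x⁻⁻ x)) (⟶-monotoneʳ x (x≼x⁻⁻ y))))))
    , (λ x y → trans (⁻⁻-⇝ x y) (sym (≼⇒[x⟶y]⇝y≡y
        (≼-trans (⇝-antitoneˡ y (x≼x⁻⁻ x)) (⇝-monotoneʳ x (x≼x⁻⁻ y))))))

  ⁻⁻-isRegular : IsRegular A (λ x → x ⁻ ⁻)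
  ⁻⁻-isRegular = trans (cong _⁻ (ax3 one)) (ax3 one)

  pSemisimple⇒≼⇒≡ : IsPSemisimple A → ∀ {x y} → x ≼ y → x ≡ y
  pSemisimple⇒≼⇒≡ ps {x} {y} x≼y = ax5 x y x≼y (ps (y ⟶ x) y⟶x≼one)
    where
    y⟶x≼one : y ⟶ x ≼ one
    y⟶x≼one = ⇝≡one⇒≼ (trans (cong ((y ⟶ x) ⇝_) (sym (≼-refl x))) (≼⇒⇝≡one (⟶-antitoneˡ x x≼y)))

  x≼d[x] : ∀ {d} → IsTypeIIImplicativeDerivation A d → IsRegular A d → ∀ x → x ≼ d x
  x≼d[x] {d} (d-⟶ , _) d-one x = subst (x ≼_) (sym d[x]≡x⋓₂d[x]) (x≼[x⇝y]⟶y x (d x))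
    where
    d[x]≡x⋓₂d[x] : d x ≡ (x ⇝ d x) ⟶ d x
    d[x]≡x⋓₂d[x] = begin
      d x                                 ≡⟨ cong d (sym (ax3 x)) ⟩
      d (one ⟶ x)                         ≡⟨ d-⟶ one x ⟩
      ((d one ⟶ x) ⇝ (one ⟶ d x)) ⟶ (one ⟶ d x)
        ≡⟨ cong₂ (λ u v → (u ⇝ v) ⟶ v) (trans (cong (_⟶ x) d-one) (ax3 x)) (ax3 (d x)) ⟩
      (x ⇝ d x) ⟶ d x                     ∎

  pSemisimple⇒onlyIdRegularTypeII : IsPSemisimple A → OnlyIdRegularTypeII A
  pSemisimple⇒onlyIdRegularTypeII ps d isDer isReg x =
    sym (pSemisimple⇒≼⇒≡ ps (x≼d[x] isDer isReg x))

  onlyIdRegularTypeII⇒kerTrivial : OnlyIdRegularTypeII A → AllRegularTypeIIKerTrivial A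
  onlyIdRegularTypeII⇒kerTrivial onlyId d isDer isReg x =
    mk⇔ (trans (sym (onlyId d isDer isReg x))) (trans (onlyId d isDer isReg x))

  kerTrivial⇒pSemisimple : AllRegularTypeIIKerTrivial A → IsPSemisimple A
  kerTrivial⇒pSemisimple kerTrivial x x≼one =
    Equivalence.to (kerTrivial (λ y → y ⁻ ⁻) ⁻⁻-isTypeIIImplicativeDerivation ⁻⁻-isRegular x)
      (trans (cong _⁻ (≼⇒⁻≡ x≼one)) ⁻⁻-isRegular)

open PseudoBCIProperties

theorem4p1 : {a : Level} (A : PseudoBCI a) →
    (IsPSemisimple A ⇔ AllRegularTypeIIKerTrivial A) ×
    (AllRegularTypeIIKerTrivial A ⇔ OnlyIdRegularTypeII A)
theorem4p1 A =
    mk⇔ (λ ps → onlyIdRegularTypeII⇒kerTrivial A (pSemisimple⇒onlyIdRegularTypeII A ps))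
        (kerTrivial⇒pSemisimple A)
  , mk⇔ (λ kt → pSemisimple⇒onlyIdRegularTypeII A (kerTrivial⇒pSemisimple A kt))
        (onlyIdRegularTypeII⇒kerTrivial A)
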